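{- Let $u,k,v_1,v_2,\ldots,v_k\in\mathbb{N}$ with $k\geq 2$. For each $t\in\{1,2,\ldots,k\}$, let $A_t$ be a $u\times v_t$ matrix with entries from $\mathbb{Q}$. If there exist positive rationals $c_2,c_3,\ldots,c_k$ such that the block matrix $(\,A_1\ \ c_2A_2\ \ c_3A_3\ \ \ldots\ \ c_kA_k\,)$ is kernel partition regular, then $(A_1,A_2,\ldots,A_k)$ is multiply kernel partition regular.
   Context: $\mathbb{N}$ denotes the set of positive integers. A finite colouring of $\mathbb{N}$ is a map $\varphi:\mathbb{N}\to\{1,\ldots,r\}$ for some $r\in\mathbb{N}$; a vector is monochromatic if $\varphi$ is constant on its entries. A $u\times v$ matrix $M$ with rational entries is kernel partition regular if whenever $\mathbb{N}$ is finitely coloured there exists a monochromatic $\vec x\in\mathbb{N}^v$ with $M\vec x=\vec 0$. A tuple $(A_1,\ldots,A_k)$ ($k\ge2$) of rational matrices, $A_t$ of size $u\times v_t$, is multiply kernel partition regular if whenever $\mathbb{N}$ is finitely coloured there exist, for each $t$, monochromatic $\vec x_t\in\mathbb{N}^{v_t}$ (different $\vec x_t$ may have different colours) such that $A_1\vec x_1+\cdots+A_k\vec x_k=\vec 0$. -}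

module Defs where

open import Data.Nat as ℕ using (ℕ; zero; suc; _≤_; NonZero)
open import Data.Fin as Fin using (Fin; zero; suc; splitAt)
import Data.Integer
open import Data.Sum using (_⊎_; inj₁; inj₂)
open import Data.Product using (Σ; ∃; _×_; _,_)
open import Data.Rational as ℚ using (ℚ; 0ℚ; 1ℚ; _+_; _*_; _<_)
open import Relation.Binary.PropositionalEquality using (_≡_)

Matrix : ℕ → ℕ → Set
Matrix u v = Fin u → Fin v → ℚ

∑ : ∀ {n} → (Fin n → ℚ) → ℚ
∑ {zero}  f = 0ℚ
∑ {suc n} f = f zero + ∑ (λ i → f (suc i))

_·_ : ∀ {u v} → Matrix u v → (Fin v → ℕ) → Fin u → ℚ
(M · x) i = ∑ (λ j → M i j * (Data.Integer.+ (x j) ℚ./ 1))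

-- A finite colouring of ℕ with r colours (only values at positive integers matter).
Colouring : ℕ → Set
Colouring r = ℕ → Fin r

Positive : ∀ {v} → (Fin v → ℕ) → Set
Positive x = ∀ j → NonZero (x j)

Monochromatic : ∀ {r v} → Colouring r → (Fin v → ℕ) → Set
Monochromatic {r} φ x = ∃ λ (c : Fin r) → ∀ j → φ (x j) ≡ c

KernelPR : ∀ {u v} → Matrix u v → Set
KernelPR {u} {v} M =
  ∀ (r : ℕ) (φ : Colouring r) →
    ∃ λ (x : Fin v → ℕ) → Positive x × Monochromatic φ x × (∀ i → (M · x) i ≡ 0ℚ)

width : ∀ {k} → (Fin k → ℕ) → ℕ
width {zero}  v = 0
width {suc k} v = v zero ℕ.+ width (λ t → v (suc t))

block : ∀ {u k} {v : Fin k → ℕ} → ((t : Fin k) → Matrix u (v t)) → Matrix u (width v)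
block {u} {zero}  A i ()
block {u} {suc k} {v} A i j with splitAt (v zero) j
... | inj₁ j' = A zero i j'
... | inj₂ j' = block (λ t → A (suc t)) i j'

scale : ∀ {u v} → ℚ → Matrix u v → Matrix u v
scale c M i j = c * M i j

∑ᵥ : ∀ {u k} → (Fin k → Fin u → ℚ) → Fin u → ℚ
∑ᵥ w i = ∑ (λ t → w t i)

MultiplyKernelPR : ∀ {u k} {v : Fin k → ℕ} → ((t : Fin k) → Matrix u (v t)) → Set
MultiplyKernelPR {u} {k} {v} A =
  ∀ (r : ℕ) (φ : Colouring r) →
    ∃ λ (x : (t : Fin k) → Fin (v t) → ℕ) →
      (∀ t → Positive (x t) × Monochromatic φ (x t)) ×
      (∀ i → ∑ᵥ (λ t → (A t · x t)) i ≡ 0ℚ)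

-- Block matrix ( A₁  c₂A₂  …  c_kA_k ): the first block is unscaled, block t ≥ 2 is scaled by c t
-- (the value c at the first index is ignored).
scaledBlock : ∀ {u k} {v : Fin k → ℕ} → (c : Fin k → ℚ) → ((t : Fin k) → Matrix u (v t)) → Matrix u (width v)
scaledBlock {u} {zero}  c A = block A
scaledBlock {u} {suc k} {v} c A = block {v = v} (λ { zero → A zero ; (suc t) → scale (c (suc t)) (A (suc t)) })

-- Clear denominators: pick L and m_t in ℕ with m_t = L c_t (where c_1 = 1). Colour n by the
-- tuple (φ(m_1 n), …, φ(m_k n)), a colouring with r^k colours. A monochromatic kernel vector y
-- of (A_1 c_2A_2 … c_kA_k) splits into blocks y_t, each x_t = m_t y_t is φ-monochromatic, and
-- Σ_t A_t x_t = L · (A_1 c_2A_2 … c_kA_k) y = 0.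
module Submission where

open import Defs
open import Algebra.Bundles using (CommutativeMonoid)
open import Data.Fin using (Fin; zero; suc; _↑ˡ_; _↑ʳ_; funToFin; finToFun)
open import Data.Fin.Properties using (splitAt-↑ˡ; splitAt-↑ʳ; finToFun-funToFin)
open import Data.Integer as ℤ using (+_)
import Data.Integer.Properties as ℤ
open import Data.Nat as ℕ using (ℕ; zero; suc; NonZero; _≤_)
import Data.Nat.Properties as ℕ
open import Data.Product using (∃; ∃₂; _×_; _,_)
open import Data.Rational as ℚ using (ℚ; 0ℚ; 1ℚ; _<_; mkℚ)
import Data.Rational.Properties as ℚ
import Data.Rational.Unnormalised as ℚᵘ
import Data.Rational.Unnormalised.Properties as ℚᵘ
open import Function using (_∘_)
open import Relation.Binary.PropositionalEquality

open import Algebra.Properties.CommutativeSemigroup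
  (CommutativeMonoid.commutativeSemigroup ℚ.*-1-commutativeMonoid)
  using (xy∙z≈xz∙y)

fromℕ : ℕ → ℚ
fromℕ n = + n ℚ./ 1

toℚᵘ-fromℕ : ∀ n → ℚ.toℚᵘ (fromℕ n) ℚᵘ.≃ ℚᵘ.mkℚᵘ (+ n) 0
toℚᵘ-fromℕ n = ℚ.toℚᵘ-fromℚᵘ (ℚᵘ.mkℚᵘ (+ n) 0)

fromℕ-* : ∀ m n → fromℕ (m ℕ.* n) ≡ fromℕ m ℚ.* fromℕ n
fromℕ-* m n = ℚ.toℚᵘ-injective (begin
  ℚ.toℚᵘ (fromℕ (m ℕ.* n))                       ≈⟨ toℚᵘ-fromℕ (m ℕ.* n) ⟩
  ℚᵘ.mkℚᵘ (+ (m ℕ.* n)) 0                         ≈⟨ ℚᵘ.*≡* (cong (ℤ._* + 1) (ℤ.pos-* m n)) ⟩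
  ℚᵘ.mkℚᵘ (+ m) 0 ℚᵘ.* ℚᵘ.mkℚᵘ (+ n) 0            ≈⟨ ℚᵘ.*-cong (toℚᵘ-fromℕ m) (toℚᵘ-fromℕ n) ⟨
  ℚ.toℚᵘ (fromℕ m) ℚᵘ.* ℚ.toℚᵘ (fromℕ n)          ≈⟨ ℚ.toℚᵘ-homo-* (fromℕ m) (fromℕ n) ⟨
  ℚ.toℚᵘ (fromℕ m ℚ.* fromℕ n)                    ∎)
  where open ℚᵘ.≃-Reasoning

positive⇒denominator-clearable : ∀ {p} → 0ℚ < p → ∃₂ λ n d → fromℕ (suc d) ℚ.* p ≡ fromℕ (suc n)
positive⇒denominator-clearable {mkℚ (+ zero) _ _} (ℚ.*<* (ℤ.+<+ ()))
positive⇒denominator-clearable {p@(mkℚ (+ suc n) d _)} _ = n , d , ℚ.toℚᵘ-injective (begin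
  ℚ.toℚᵘ (fromℕ (suc d) ℚ.* p)                    ≈⟨ ℚ.toℚᵘ-homo-* (fromℕ (suc d)) p ⟩
  ℚ.toℚᵘ (fromℕ (suc d)) ℚᵘ.* ℚᵘ.mkℚᵘ (+ suc n) d ≈⟨ ℚᵘ.*-congʳ (toℚᵘ-fromℕ (suc d)) ⟩
  ℚᵘ.mkℚᵘ (+ suc d) 0 ℚᵘ.* ℚᵘ.mkℚᵘ (+ suc n) d    ≈⟨ ℚᵘ.*≡* cross ⟩
  ℚᵘ.mkℚᵘ (+ suc n) 0                             ≈⟨ toℚᵘ-fromℕ (suc n) ⟨
  ℚ.toℚᵘ (fromℕ (suc n))                          ∎)
  where
  open ℚᵘ.≃-Reasoning
  cross : (+ suc d ℤ.* + suc n) ℤ.* + 1 ≡ + suc n ℤ.* + (1 ℕ.* suc d)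
  cross = trans (ℤ.*-identityʳ _)
    (trans (ℤ.*-comm (+ suc d) (+ suc n)) (cong (λ e → + suc n ℤ.* + e) (sym (ℕ.*-identityˡ (suc d)))))
positive⇒denominator-clearable {mkℚ ℤ.-[1+ _ ] _ _} (ℚ.*<* ())

denominators-clearable : ∀ {k} (c : Fin k → ℚ) → (∀ t → 0ℚ < c t) →
  ∃₂ λ L (m : Fin k → ℕ) →
    NonZero L × (∀ t → NonZero (m t)) × (∀ t → fromℕ (m t) ≡ fromℕ L ℚ.* c t)
denominators-clearable {zero} c _ = 1 , (λ ()) , _ , (λ ()) , (λ ())
denominators-clearable {suc k} c c>0
  with positive⇒denominator-clearable (c>0 zero) | denominators-clearable (c ∘ suc) (c>0 ∘ suc)
... | n , d , dc≡n | L , m , L≢0 , m≢0 , m≡Lc = suc d ℕ.* L , m′ , dL≢0 , m′≢0 , m′≡dLc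
  where
  m′ : Fin (suc k) → ℕ
  m′ zero    = suc n ℕ.* L
  m′ (suc t) = suc d ℕ.* m t

  dL≢0 : NonZero (suc d ℕ.* L)
  dL≢0 = ℕ.m*n≢0 (suc d) L {{_}} {{L≢0}}

  m′≢0 : ∀ t → NonZero (m′ t)
  m′≢0 zero    = ℕ.m*n≢0 (suc n) L {{_}} {{L≢0}}
  m′≢0 (suc t) = ℕ.m*n≢0 (suc d) (m t) {{_}} {{m≢0 t}}

  m′≡dLc : ∀ t → fromℕ (m′ t) ≡ fromℕ (suc d ℕ.* L) ℚ.* c t
  m′≡dLc zero = begin
    fromℕ (suc n ℕ.* L)                        ≡⟨ fromℕ-* (suc n) L ⟩
    fromℕ (suc n) ℚ.* fromℕ L                  ≡⟨ cong (ℚ._* fromℕ L) dc≡n ⟨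
    fromℕ (suc d) ℚ.* c zero ℚ.* fromℕ L       ≡⟨ xy∙z≈xz∙y (fromℕ (suc d)) (c zero) (fromℕ L) ⟩
    fromℕ (suc d) ℚ.* fromℕ L ℚ.* c zero       ≡⟨ cong (ℚ._* c zero) (fromℕ-* (suc d) L) ⟨
    fromℕ (suc d ℕ.* L) ℚ.* c zero             ∎
    where open ≡-Reasoning
  m′≡dLc (suc t) = begin
    fromℕ (suc d ℕ.* m t)                      ≡⟨ fromℕ-* (suc d) (m t) ⟩
    fromℕ (suc d) ℚ.* fromℕ (m t)              ≡⟨ cong (fromℕ (suc d) ℚ.*_) (m≡Lc t) ⟩
    fromℕ (suc d) ℚ.* (fromℕ L ℚ.* c (suc t))  ≡⟨ ℚ.*-assoc (fromℕ (suc d)) (fromℕ L) (c (suc t)) ⟨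
    fromℕ (suc d) ℚ.* fromℕ L ℚ.* c (suc t)    ≡⟨ cong (ℚ._* c (suc t)) (fromℕ-* (suc d) L) ⟨
    fromℕ (suc d ℕ.* L) ℚ.* c (suc t)          ∎
    where open ≡-Reasoning

∑-cong : ∀ {n} {f g : Fin n → ℚ} → (∀ i → f i ≡ g i) → ∑ f ≡ ∑ g
∑-cong {zero}  f≗g = refl
∑-cong {suc n} f≗g = cong₂ ℚ._+_ (f≗g zero) (∑-cong (f≗g ∘ suc))

∑-++ : ∀ m {n} (f : Fin (m ℕ.+ n) → ℚ) → ∑ f ≡ ∑ (λ i → f (i ↑ˡ n)) ℚ.+ ∑ (λ i → f (m ↑ʳ i))
∑-++ zero    f = sym (ℚ.+-identityˡ (∑ f))
∑-++ (suc m) f = trans (cong (f zero ℚ.+_) (∑-++ m (f ∘ suc))) (sym (ℚ.+-assoc (f zero) _ _))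

∑-distribˡ : ∀ {n} a (f : Fin n → ℚ) → ∑ (λ i → a ℚ.* f i) ≡ a ℚ.* ∑ f
∑-distribˡ {zero}  a f = sym (ℚ.*-zeroʳ a)
∑-distribˡ {suc n} a f =
  trans (cong (a ℚ.* f zero ℚ.+_) (∑-distribˡ a (f ∘ suc))) (sym (ℚ.*-distribˡ-+ a _ _))

scale-· : ∀ {u v} c (M : Matrix u v) y i → (scale c M · y) i ≡ c ℚ.* (M · y) i
scale-· c M y i =
  trans (∑-cong λ j → ℚ.*-assoc c (M i j) (fromℕ (y j))) (∑-distribˡ c (λ j → M i j ℚ.* fromℕ (y j)))

·-*ℕ : ∀ {u v} (M : Matrix u v) m y i → (M · (λ j → m ℕ.* y j)) i ≡ fromℕ m ℚ.* (M · y) i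
·-*ℕ M m y i = trans (∑-cong entry) (scale-· (fromℕ m) M y i)
  where
  entry : ∀ j → M i j ℚ.* fromℕ (m ℕ.* y j) ≡ fromℕ m ℚ.* M i j ℚ.* fromℕ (y j)
  entry j = begin
    M i j ℚ.* fromℕ (m ℕ.* y j)            ≡⟨ cong (M i j ℚ.*_) (fromℕ-* m (y j)) ⟩
    M i j ℚ.* (fromℕ m ℚ.* fromℕ (y j))    ≡⟨ ℚ.*-assoc (M i j) (fromℕ m) (fromℕ (y j)) ⟨
    M i j ℚ.* fromℕ m ℚ.* fromℕ (y j)      ≡⟨ cong (ℚ._* fromℕ (y j)) (ℚ.*-comm (M i j) (fromℕ m)) ⟩
    fromℕ m ℚ.* M i j ℚ.* fromℕ (y j)      ∎
    where open ≡-Reasoning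

column : ∀ {k} {v : Fin k → ℕ} (t : Fin k) → Fin (v t) → Fin (width v)
column {suc k} {v} zero    j = j ↑ˡ width (v ∘ suc)
column {suc k} {v} (suc t) j = v zero ↑ʳ column t j

module _ {u k} {v : Fin (suc k) → ℕ} (B : (t : Fin (suc k)) → Matrix u (v t)) (i : Fin u) where

  block-↑ˡ : ∀ j → block B i (j ↑ˡ width (v ∘ suc)) ≡ B zero i j
  block-↑ˡ j rewrite splitAt-↑ˡ (v zero) j (width (v ∘ suc)) = refl

  block-↑ʳ : ∀ j → block B i (v zero ↑ʳ j) ≡ block (B ∘ suc) i j
  block-↑ʳ j rewrite splitAt-↑ʳ (v zero) (width (v ∘ suc)) j = refl

block-· : ∀ {u k} {v : Fin k → ℕ} (B : (t : Fin k) → Matrix u (v t)) y i →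
  (block B · y) i ≡ ∑ (λ t → (B t · (y ∘ column t)) i)
block-· {k = zero}      B y i = refl
block-· {k = suc k} {v} B y i = trans (∑-++ (v zero) _) (cong₂ ℚ._+_
  (∑-cong λ j → cong (ℚ._* fromℕ (y (j ↑ˡ _))) (block-↑ˡ B i j))
  (trans (∑-cong λ j → cong (ℚ._* fromℕ (y (v zero ↑ʳ j))) (block-↑ʳ B i j))
         (block-· (B ∘ suc) (λ j → y (v zero ↑ʳ j)) i)))

productColouring : ∀ {r k} → (Fin k → Colouring r) → Colouring (r ℕ.^ k)
productColouring φ n = funToFin (λ t → φ t n)

Monochromatic-productColouring : ∀ {r k v} (φ : Fin k → Colouring r) (y : Fin v → ℕ) →
  Monochromatic (productColouring φ) y → ∀ t → Monochromatic (φ t) y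
Monochromatic-productColouring φ y (c , φy≡c) t = finToFun c t , λ j → begin
  φ t (y j)                                ≡⟨ finToFun-funToFin (λ s → φ s (y j)) t ⟨
  finToFun (productColouring φ (y j)) t    ≡⟨ cong (λ c′ → finToFun c′ t) (φy≡c j) ⟩
  finToFun c t                             ∎
  where open ≡-Reasoning

KernelPR-block⇒MultiplyKernelPR : ∀ {u k} {v : Fin k → ℕ} (A B : (t : Fin k) → Matrix u (v t))
  (L : ℕ) (m : Fin k → ℕ) → (∀ t → NonZero (m t)) →
  (∀ t y i → (A t · (λ j → m t ℕ.* y j)) i ≡ fromℕ L ℚ.* (B t · y) i) →
  KernelPR (block B) → MultiplyKernelPR A
KernelPR-block⇒MultiplyKernelPR {k = k} {v} A B L m m≢0 A·m≡L·B kpr r φ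
  with kpr (r ℕ.^ k) (productColouring (λ t n → φ (m t ℕ.* n)))
... | y , y>0 , y-mono , B·y≡0 = x , (λ t → x>0 t , x-mono t) , ∑A·x≡0
  where
  x : (t : Fin k) → Fin (v t) → ℕ
  x t j = m t ℕ.* y (column t j)

  x>0 : ∀ t → Positive (x t)
  x>0 t j = ℕ.m*n≢0 (m t) (y (column t j)) {{m≢0 t}} {{y>0 (column t j)}}

  x-mono : ∀ t → Monochromatic φ (x t)
  x-mono t with Monochromatic-productColouring (λ t n → φ (m t ℕ.* n)) y y-mono t
  ... | c , φmy≡c = c , φmy≡c ∘ column t

  ∑A·x≡0 : ∀ i → ∑ᵥ (λ t → A t · x t) i ≡ 0ℚ
  ∑A·x≡0 i = begin
    ∑ (λ t → (A t · x t) i)                             ≡⟨ ∑-cong (λ t → A·m≡L·B t (y ∘ column t) i) ⟩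
    ∑ (λ t → fromℕ L ℚ.* (B t · (y ∘ column t)) i)     ≡⟨ ∑-distribˡ (fromℕ L) (λ t → (B t · (y ∘ column t)) i) ⟩
    fromℕ L ℚ.* ∑ (λ t → (B t · (y ∘ column t)) i)     ≡⟨ cong (fromℕ L ℚ.*_) (block-· B y i) ⟨
    fromℕ L ℚ.* (block B · y) i                        ≡⟨ cong (fromℕ L ℚ.*_) (B·y≡0 i) ⟩
    fromℕ L ℚ.* 0ℚ                                     ≡⟨ ℚ.*-zeroʳ (fromℕ L) ⟩
    0ℚ                                                 ∎
    where open ≡-Reasoning

KernelPR-rescaledBlock⇒MultiplyKernelPR : ∀ {u k} {v : Fin k → ℕ} (A B : (t : Fin k) → Matrix u (v t))
  (c : Fin k → ℚ) → (∀ t → 0ℚ < c t) → (∀ t y i → (B t · y) i ≡ c t ℚ.* (A t · y) i) →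
  KernelPR (block B) → MultiplyKernelPR A
KernelPR-rescaledBlock⇒MultiplyKernelPR A B c c>0 B≡c·A
  with denominators-clearable c c>0
... | L , m , _ , m≢0 , m≡L·c = KernelPR-block⇒MultiplyKernelPR A B L m m≢0 A·m≡L·B
  where
  A·m≡L·B : ∀ t y i → (A t · (λ j → m t ℕ.* y j)) i ≡ fromℕ L ℚ.* (B t · y) i
  A·m≡L·B t y i = begin
    (A t · (λ j → m t ℕ.* y j)) i          ≡⟨ ·-*ℕ (A t) (m t) y i ⟩
    fromℕ (m t) ℚ.* (A t · y) i            ≡⟨ cong (ℚ._* (A t · y) i) (m≡L·c t) ⟩
    fromℕ L ℚ.* c t ℚ.* (A t · y) i        ≡⟨ ℚ.*-assoc (fromℕ L) (c t) ((A t · y) i) ⟩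
    fromℕ L ℚ.* (c t ℚ.* (A t · y) i)      ≡⟨ cong (fromℕ L ℚ.*_) (B≡c·A t y i) ⟨
    fromℕ L ℚ.* (B t · y) i                ∎
    where open ≡-Reasoning

lemma2p1 : (u k : ℕ) → 2 ≤ k → (v : Fin k → ℕ) → (A : (t : Fin k) → Matrix u (v t)) →
    (∃ λ (c : Fin k → ℚ) → (∀ t → 0ℚ < c t) ×
        KernelPR (scaledBlock {u} {k} {v} c A)) →
    MultiplyKernelPR {u} {k} {v} A
lemma2p1 u zero () v A
lemma2p1 u (suc k) _ v A (c , c>0 , kpr) =
  KernelPR-rescaledBlock⇒MultiplyKernelPR A _ c′ c′>0
    (λ where zero    y i → sym (ℚ.*-identityˡ ((A zero · y) i))
             (suc t) y i → scale-· (c (suc t)) (A (suc t)) y i)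
    kpr
  where
  c′ : Fin (suc k) → ℚ
  c′ zero    = 1ℚ
  c′ (suc t) = c (suc t)

  c′>0 : ∀ t → 0ℚ < c′ t
  c′>0 zero    = ℚ.positive⁻¹ 1ℚ
  c′>0 (suc t) = c>0 (suc t)
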